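{- Let $\mathbb{A},\mathbb{B}$ be sets of $\Phi$-teams. If $D(\mathbb{A},\mathbb{B})>1$, then no $\Phi$-literal separates $\mathbb{A}$ from $\mathbb{B}$.
   Context: A $\Phi$-team is a set of maps $\Phi\to\{0,1\}$, $\Phi$ a finite set of variables. $\Phi$-literals are $\top,\bot,{\sim}\top,{\sim}\bot,p,\neg p,{\sim}p,{\sim}\neg p$ ($p\in\Phi$), with $T\models\top$ always, $T\models\bot$ iff $T=\emptyset$, $T\models p$ iff $s(p)=1$ for all $s\in T$, $T\models\neg p$ iff $s(p)=0$ for all $s\in T$, and $T\models{\sim}\ell$ iff $T\not\models\ell$. A literal $\ell$ separates $\mathbb{A}$ from $\mathbb{B}$ if $A\models\ell$ for all $A\in\mathbb{A}$ and $B\not\models\ell$ for all $B\in\mathbb{B}$. A team $T'$ is a neighbour of $T$ if $T'=T\setminus\{s\}$ for some $s\in T$; $N(T,\mathbb{B})$ is the number of neighbours of $T$ in $\mathbb{B}$; $D(\mathbb{A},\mathbb{B})=\max\{N(A,\mathbb{B}):A\in\mathbb{A}\}$. -}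

module Defs where

open import Data.Nat using (ℕ; zero; suc; _⊔_)
open import Data.Bool using (Bool; true; false; _∧_; _∨_; not; if_then_else_)
open import Data.Fin using (Fin)
open import Data.Vec using (Vec; []; _∷_; lookup)
open import Data.List using (List; []; _∷_; map; filter; length; foldr; concatMap)
open import Data.Product using (_×_; _,_)
open import Relation.Binary.PropositionalEquality using (_≡_)
open import Relation.Nullary using (¬_)
open import Data.Bool.Properties using (T?)
open import Data.Bool using (T)

-- Φ = Fin n (an arbitrary finite set of n propositional variables).
-- An assignment s : Φ → {0,1} is a Boolean vector of length n.
Assignment : ℕ → Set
Assignment n = Vec Bool n

-- A Φ-team (a set of assignments) is represented canonically as a
-- binary decision tree of membership bits: Team 0 says whether the
-- unique empty assignment belongs to the team; a Team (suc n) is a pair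
-- (teams of tails of assignments with head false , with head true).
-- This representation is in bijection with sets of assignments and makes
-- equality of teams propositional equality.
Team : ℕ → Set
Team zero = Bool
Team (suc n) = Team n × Team n

_∈T_ : ∀ {n} → Assignment n → Team n → Bool
_∈T_ {zero} [] b = b
_∈T_ {suc n} (false ∷ s) (T₀ , T₁) = s ∈T T₀
_∈T_ {suc n} (true ∷ s) (T₀ , T₁) = s ∈T T₁

emptyTeam : ∀ n → Team n
emptyTeam zero = false
emptyTeam (suc n) = emptyTeam n , emptyTeam n

remove : ∀ {n} → Assignment n → Team n → Team n
remove {zero} [] b = false
remove {suc n} (false ∷ s) (T₀ , T₁) = remove s T₀ , T₁
remove {suc n} (true ∷ s) (T₀ , T₁) = T₀ , remove s T₁

allAssignments : ∀ n → List (Assignment n)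
allAssignments zero = [] ∷ []
allAssignments (suc n) =
  map (false ∷_) (allAssignments n) Data.List.++ map (true ∷_) (allAssignments n)

allTeams : ∀ n → List (Team n)
allTeams zero = false ∷ true ∷ []
allTeams (suc n) = concatMap (λ T₀ → map (T₀ ,_) (allTeams n)) (allTeams n)

TeamSet : ℕ → Set
TeamSet n = Team n → Bool

-- N(T, 𝔹): the number of neighbours T \ {s} (s ∈ T) of T lying in 𝔹.
-- Distinct s ∈ T give distinct neighbours, so counting the s is counting
-- the neighbours.
N : ∀ {n} → Team n → TeamSet n → ℕ
N {n} T 𝔹 = length (filter (λ s → T? (s ∈T T ∧ 𝔹 (remove s T))) (allAssignments n))

-- D(𝔸, 𝔹) = max { N(A, 𝔹) : A ∈ 𝔸 }  (max of the empty set taken as 0)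
D : ∀ {n} → TeamSet n → TeamSet n → ℕ
D {n} 𝔸 𝔹 = foldr _⊔_ 0 (map (λ A → if 𝔸 A then N A 𝔹 else 0) (allTeams n))

data Atom (n : ℕ) : Set where
  top : Atom n
  bot : Atom n
  var : Fin n → Atom n
  negvar : Fin n → Atom n

data Literal (n : ℕ) : Set where
  pos   : Atom n → Literal n
  tilde : Atom n → Literal n

_⊨A_ : ∀ {n} → Team n → Atom n → Set
T ⊨A top = Data.Unit.⊤ where import Data.Unit
_⊨A_ {n} T bot = T ≡ emptyTeam n
T ⊨A var p = ∀ s → s ∈T T ≡ true → lookup s p ≡ true
T ⊨A negvar p = ∀ s → s ∈T T ≡ true → lookup s p ≡ false

_⊨_ : ∀ {n} → Team n → Literal n → Set
T ⊨ pos a = T ⊨A a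
T ⊨ tilde a = ¬ (T ⊨A a)

Separates : ∀ {n} → Literal n → TeamSet n → TeamSet n → Set
Separates ℓ 𝔸 𝔹 = (∀ A → 𝔸 A ≡ true → A ⊨ ℓ) × (∀ B → 𝔹 B ≡ true → ¬ (B ⊨ ℓ))

-- Some A ∈ 𝔸 has two distinct neighbours A ∖ {s₁}, A ∖ {s₂} in 𝔹, and no literal
-- tells A apart from both. Every atom survives removing an assignment, which refutes
-- a separating literal a; and every atom holding in both neighbours holds in A
-- (vacuously for ⊥, as s₂ ∈ A ∖ {s₁}), which refutes a separating ∼a.
module Submission where

open import Defs
open import Data.Nat using (ℕ; zero; suc; _<_; _⊔_; s≤s)
open import Data.Nat.Properties using (⊔-sel)
open import Data.Bool using (Bool; true; false; T; _∧_)
open import Data.Bool.Properties using (T?; T-≡; T-∧) renaming (_≟_ to _≟ᵇ_)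
open import Data.Vec using ([]; _∷_)
open import Data.Vec.Properties using (≡-dec)
open import Data.List using (List; []; _∷_; map; filter; length; foldr)
open import Data.List.Relation.Unary.Any using (Any; here; there; satisfied)
open import Data.List.Relation.Unary.Any.Properties using (map⁻)
open import Data.List.Relation.Unary.All using ([]; _∷_)
open import Data.List.Relation.Unary.AllPairs using ([]; _∷_)
open import Data.List.Relation.Unary.Unique.Propositional using (Unique)
open import Data.List.Relation.Unary.Unique.Propositional.Properties using (map⁺; ++⁺; filter⁺)
open import Data.List.Membership.Propositional using (_∈_)
open import Data.List.Membership.Propositional.Properties using (∈-map⁻; ∈-filter⁻)
open import Data.Product using (∃-syntax; ∃₂; _×_; _,_; proj₂) renaming (map to map-×)
open import Data.Sum using (inj₁; inj₂)
open import Data.Empty using (⊥; ⊥-elim)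
open import Data.Unit using (tt)
open import Function using (_∘_)
open import Function.Bundles using (Equivalence)
open import Relation.Nullary using (¬_; Dec; yes; no)
open import Relation.Binary.PropositionalEquality using (_≡_; _≢_; refl; sym; trans; cong; subst)

private
  variable
    n : ℕ

foldr-⊔-witness : ∀ {k} (ms : List ℕ) → k < foldr _⊔_ 0 ms → Any (k <_) ms
foldr-⊔-witness (m ∷ ms) k<max with ⊔-sel m (foldr _⊔_ 0 ms)
... | inj₁ eq = here (subst (_ <_) eq k<max)
... | inj₂ eq = there (foldr-⊔-witness ms (subst (_ <_) eq k<max))

unique-two-distinct : ∀ {A : Set} {xs : List A} → Unique xs → 1 < length xs →
                      ∃₂ λ x y → x ∈ xs × y ∈ xs × x ≢ y
unique-two-distinct {xs = _ ∷ []} _ (s≤s ())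
unique-two-distinct {xs = x ∷ y ∷ _} ((x≢y ∷ _) ∷ _) _ = x , y , here refl , there (here refl) , x≢y

_≟ₐ_ : (s t : Assignment n) → Dec (s ≡ t)
_≟ₐ_ = ≡-dec _≟ᵇ_

∷-injectiveʳ : ∀ {b : Bool} {s t : Assignment n} → b ∷ s ≡ b ∷ t → s ≡ t
∷-injectiveʳ refl = refl

allAssignments-unique : ∀ n → Unique (allAssignments n)
allAssignments-unique zero = [] ∷ []
allAssignments-unique (suc n) =
  ++⁺ (map⁺ ∷-injectiveʳ (allAssignments-unique n))
      (map⁺ ∷-injectiveʳ (allAssignments-unique n))
      heads-differ
  where
  heads-differ : ∀ {v} → v ∈ map (false ∷_) (allAssignments n) × v ∈ map (true ∷_) (allAssignments n) → ⊥
  heads-differ (v∈₀ , v∈₁) with ∈-map⁻ (false ∷_) v∈₀ | ∈-map⁻ (true ∷_) v∈₁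
  ... | _ , _ , refl | _ , _ , ()

∈T-emptyTeam : (s : Assignment n) → s ∈T emptyTeam n ≡ false
∈T-emptyTeam {zero} [] = refl
∈T-emptyTeam {suc n} (false ∷ s) = ∈T-emptyTeam s
∈T-emptyTeam {suc n} (true ∷ s) = ∈T-emptyTeam s

∈T⇒≢emptyTeam : ∀ {s : Assignment n} {T} → s ∈T T ≡ true → T ≢ emptyTeam n
∈T⇒≢emptyTeam {s = s} s∈T refl with trans (sym s∈T) (∈T-emptyTeam s)
... | ()

remove-emptyTeam : (s : Assignment n) → remove s (emptyTeam n) ≡ emptyTeam n
remove-emptyTeam {zero} [] = refl
remove-emptyTeam {suc n} (false ∷ s) = cong (_, emptyTeam n) (remove-emptyTeam s)
remove-emptyTeam {suc n} (true ∷ s) = cong (emptyTeam n ,_) (remove-emptyTeam s)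

∈T-remove⁻ : (s t : Assignment n) (T : Team n) → s ∈T remove t T ≡ true → s ∈T T ≡ true
∈T-remove⁻ {zero} [] [] b ()
∈T-remove⁻ {suc n} (false ∷ s) (false ∷ t) (T₀ , T₁) = ∈T-remove⁻ s t T₀
∈T-remove⁻ {suc n} (false ∷ s) (true ∷ t) (T₀ , T₁) s∈ = s∈
∈T-remove⁻ {suc n} (true ∷ s) (false ∷ t) (T₀ , T₁) s∈ = s∈
∈T-remove⁻ {suc n} (true ∷ s) (true ∷ t) (T₀ , T₁) = ∈T-remove⁻ s t T₁

∈T-remove⁺ : (s t : Assignment n) (T : Team n) → s ≢ t → s ∈T T ≡ true → s ∈T remove t T ≡ true
∈T-remove⁺ {zero} [] [] b s≢t _ = ⊥-elim (s≢t refl)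
∈T-remove⁺ {suc n} (false ∷ s) (false ∷ t) (T₀ , T₁) s≢t = ∈T-remove⁺ s t T₀ (s≢t ∘ cong (false ∷_))
∈T-remove⁺ {suc n} (false ∷ s) (true ∷ t) (T₀ , T₁) _ s∈ = s∈
∈T-remove⁺ {suc n} (true ∷ s) (false ∷ t) (T₀ , T₁) _ s∈ = s∈
∈T-remove⁺ {suc n} (true ∷ s) (true ∷ t) (T₀ , T₁) s≢t = ∈T-remove⁺ s t T₁ (s≢t ∘ cong (true ∷_))

Everywhere : (Assignment n → Set) → Team n → Set
Everywhere P T = ∀ s → s ∈T T ≡ true → P s

Everywhere-remove : ∀ {P : Assignment n → Set} {T} t → Everywhere P T → Everywhere P (remove t T)
Everywhere-remove {T = T} t P-T s s∈ = P-T s (∈T-remove⁻ s t T s∈)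

Everywhere-glue : ∀ {P : Assignment n → Set} {T} {s₁ s₂} → s₁ ≢ s₂ →
                  Everywhere P (remove s₁ T) → Everywhere P (remove s₂ T) → Everywhere P T
Everywhere-glue {T = T} {s₁} {s₂} s₁≢s₂ P-T₁ P-T₂ s s∈ with s ≟ₐ s₁
... | yes refl = P-T₂ s (∈T-remove⁺ s s₂ T s₁≢s₂ s∈)
... | no s≢s₁ = P-T₁ s (∈T-remove⁺ s s₁ T s≢s₁ s∈)

⊨A-remove : ∀ {T : Team n} (a : Atom n) t → T ⊨A a → remove t T ⊨A a
⊨A-remove top t _ = tt
⊨A-remove bot t refl = remove-emptyTeam t
⊨A-remove (var p) t = Everywhere-remove t
⊨A-remove (negvar p) t = Everywhere-remove t

⊨A-glue : ∀ {T : Team n} (a : Atom n) {s₁ s₂} → s₁ ≢ s₂ → s₂ ∈T T ≡ true →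
          remove s₁ T ⊨A a → remove s₂ T ⊨A a → T ⊨A a
⊨A-glue top _ _ _ _ = tt
⊨A-glue {T = T} bot {s₁} {s₂} s₁≢s₂ s₂∈T T-s₁≡∅ _ =
  ⊥-elim (∈T⇒≢emptyTeam (∈T-remove⁺ s₂ s₁ T (s₁≢s₂ ∘ sym) s₂∈T) T-s₁≡∅)
⊨A-glue (var p) s₁≢s₂ _ = Everywhere-glue s₁≢s₂
⊨A-glue (negvar p) s₁≢s₂ _ = Everywhere-glue s₁≢s₂

D-witness : {𝔸 𝔹 : TeamSet n} → 1 < D 𝔸 𝔹 → ∃[ A ] 𝔸 A ≡ true × 1 < N A 𝔹
D-witness {n} {𝔸} 1<D with satisfied (map⁻ (foldr-⊔-witness (map _ (allTeams n)) 1<D))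
... | A , 1<N with 𝔸 A in A∈𝔸 | 1<N
... | true  | 1<N = A , A∈𝔸 , 1<N
... | false | ()

N-two-neighbours : ∀ {A : Team n} {𝔹} → 1 < N A 𝔹 →
                   ∃₂ λ s₁ s₂ → s₁ ≢ s₂ × s₂ ∈T A ≡ true ×
                                 𝔹 (remove s₁ A) ≡ true × 𝔹 (remove s₂ A) ≡ true
N-two-neighbours {n} {A} {𝔹} 1<N =
  let s₁ , s₂ , s₁∈ , s₂∈ , s₁≢s₂ = unique-two-distinct (filter⁺ neighbour? (allAssignments-unique n)) 1<N
      _ , A-s₁∈𝔹 = neighbour⁻ s₁∈
      s₂∈A , A-s₂∈𝔹 = neighbour⁻ s₂∈
  in s₁ , s₂ , s₁≢s₂ , s₂∈A , A-s₁∈𝔹 , A-s₂∈𝔹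
  where
  neighbour? : ∀ s → Dec (T (s ∈T A ∧ 𝔹 (remove s A)))
  neighbour? s = T? (s ∈T A ∧ 𝔹 (remove s A))

  neighbour⁻ : ∀ {s} → s ∈ filter neighbour? (allAssignments n) → s ∈T A ≡ true × 𝔹 (remove s A) ≡ true
  neighbour⁻ s∈ = map-× (Equivalence.to T-≡) (Equivalence.to T-≡)
                    (Equivalence.to T-∧ (proj₂ (∈-filter⁻ neighbour? {xs = allAssignments n} s∈)))

lemma3p6 : (n : ℕ) (𝔸 𝔹 : TeamSet n) → 1 < D 𝔸 𝔹 → (ℓ : Literal n) → ¬ Separates ℓ 𝔸 𝔹
lemma3p6 n 𝔸 𝔹 1<D ℓ (𝔸⊨ℓ , 𝔹⊭ℓ)
  with A , A∈𝔸 , 1<N ← D-witness {𝔸 = 𝔸} {𝔹} 1<D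
  with s₁ , s₂ , s₁≢s₂ , s₂∈A , A-s₁∈𝔹 , A-s₂∈𝔹 ← N-two-neighbours {A = A} {𝔹} 1<N
  with ℓ
... | pos a = 𝔹⊭ℓ _ A-s₁∈𝔹 (⊨A-remove a s₁ (𝔸⊨ℓ A A∈𝔸))
... | tilde a =
  𝔹⊭ℓ _ A-s₁∈𝔹 λ A-s₁⊨a →
  𝔹⊭ℓ _ A-s₂∈𝔹 λ A-s₂⊨a →
  𝔸⊨ℓ A A∈𝔸 (⊨A-glue a s₁≢s₂ s₂∈A A-s₁⊨a A-s₂⊨a)
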